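{- For all $n\ge1$, the parity-constrained Hanoi graph $P^n$ contains a Hamiltonian cycle.
   Context: Let $Q=\{0,1,2,3\}$ (pegs: $0,3$ neutral; $1$ reserved for even discs; $2$ reserved for odd discs). For a disc $d\in\{1,\dots,n\}$ let $p(d)=1$ if $d$ is even and $p(d)=2$ if $d$ is odd, and $Q^d=\{0,p(d),3\}$. The vertices of $P^n$ are words $s=s_n\cdots s_1\in Q^n$ ($s_d$ is the peg of disc $d$) with $s_d\in Q^d$ for all $d$. Two vertices are adjacent iff they differ in exactly one coordinate $d$, with values $i\ne j$ there, $i,j\in Q^d$, and $s_k\notin\{i,j\}$ for all $k<d$. -}

module Defs where

open import Data.Nat using (ℕ; zero; suc; _<_; _≤_)
open import Data.Nat.Divisibility using (_∣_)
open import Data.Fin using (Fin; toℕ)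
import Data.Fin as Fin
open import Data.Empty using (⊥)
open import Data.Vec using (Vec; lookup)
open import Data.List using (List; []; _∷_; length)
open import Data.List.Membership.Propositional using (_∈_)
open import Data.List.Relation.Unary.All using (All)
open import Data.List.Relation.Unary.Unique.Propositional using (Unique)
open import Data.Product using (Σ; _×_; ∃)
open import Data.Sum using (_⊎_)
open import Relation.Nullary using (¬_)
open import Relation.Binary.PropositionalEquality using (_≡_; _≢_)

Peg : Set
Peg = Fin 4

-- Disc number d ∈ {1,…,n} is represented by i : Fin n with d = toℕ i + 1.
disc : ∀ {n} → Fin n → ℕ
disc i = suc (toℕ i)

data AllowedPeg (d : ℕ) : Peg → Set where
  neutral0 : AllowedPeg d (Fin.zero)
  neutral3 : AllowedPeg d (Fin.suc (Fin.suc (Fin.suc Fin.zero)))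
  evenPeg  : 2 ∣ d → AllowedPeg d (Fin.suc Fin.zero)
  oddPeg   : ¬ 2 ∣ d → AllowedPeg d (Fin.suc (Fin.suc Fin.zero))

-- A word s = s_n ⋯ s_1; lookup s i is the peg of disc (toℕ i + 1).
Word : ℕ → Set
Word n = Vec Peg n

IsVertex : ∀ {n} → Word n → Set
IsVertex {n} s = (i : Fin n) → AllowedPeg (disc i) (lookup s i)

Adjacent : ∀ {n} → Word n → Word n → Set
Adjacent {n} s t = Σ (Fin n) λ d →
    (lookup s d ≢ lookup t d)
  × AllowedPeg (disc d) (lookup s d)
  × AllowedPeg (disc d) (lookup t d)
  × ((k : Fin n) → k ≢ d → lookup s k ≡ lookup t k)
  × ((k : Fin n) → toℕ k < toℕ d →
       (lookup s k ≢ lookup s d) × (lookup s k ≢ lookup t d))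

ChainFrom : ∀ {n} → Word n → Word n → List (Word n) → Set
ChainFrom first prev []       = Adjacent prev first
ChainFrom first prev (v ∷ vs) = Adjacent prev v × ChainFrom first v vs

IsCycle : ∀ {n} → List (Word n) → Set
IsCycle []       = ⊥
IsCycle (v ∷ vs) = ChainFrom v v vs

HamiltonianCycle : (n : ℕ) → List (Word n) → Set
HamiltonianCycle n c =
    (3 ≤ length c)
  × All IsVertex c
  × Unique c
  × ((s : Word n) → IsVertex s → s ∈ c)
  × IsCycle c

-- Call a word perfect when every disc sits on the same role of peg: all on 0, all on 3, or every
-- disc on its own reserved peg. By induction on n there is a Hamiltonian path of P^n between any
-- two distinct perfect words. For a path from perfect ρ to perfect τ in P^(n+1), let σ be the
-- third role and split P^(n+1) into three copies of P^n according to the top disc. Traverse the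
-- layer with the top disc on ρ from perfect ρ to perfect τ, move the top disc to σ (legal, since
-- every smaller disc is on a τ-peg), traverse that layer back from perfect τ to perfect ρ, move
-- the top disc to τ, and traverse the last layer from perfect ρ to perfect τ. Three such paths,
-- using the three possible positions of the top disc in turn, close up into a Hamiltonian cycle.
module Submission where

open import Defs
open import Data.Nat using (ℕ; zero; suc; _≤_; _<_; s≤s; z≤n)
open import Data.Nat.Properties using (<-irrefl; <-trans; m≤n⇒m≤1+n)
open import Data.Nat.Divisibility using (_∣?_)
open import Data.Fin using (Fin; toℕ; inject₁; fromℕ; #_)
import Data.Fin as Fin
open import Data.Fin.Properties using (toℕ-inject₁; toℕ-fromℕ; toℕ<n)
open import Data.Vec using (Vec; []; _∷_; lookup; _∷ʳ_; initLast)
open import Data.Vec.Properties using (∷ʳ-injectiveˡ; ∷ʳ-injectiveʳ)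
open import Data.List using (List; []; _∷_; map; _++_; length)
open import Data.List.Membership.Propositional using (_∈_)
open import Data.List.Membership.Propositional.Properties
  using (∈-map⁺; ∈-map⁻; ∈-++⁺ˡ; ∈-++⁺ʳ; ∈-++⁻)
open import Data.List.Relation.Unary.All using (All; []; _∷_)
import Data.List.Relation.Unary.All.Properties as All
open import Data.List.Relation.Unary.Any using (here)
open import Data.List.Relation.Unary.Unique.Propositional using (Unique; []; _∷_)
import Data.List.Relation.Unary.Unique.Propositional.Properties as Unique
open import Data.List.Relation.Binary.Disjoint.Propositional using (Disjoint)
open import Data.Product using (Σ; ∃; _×_; _,_; proj₁; proj₂)
open import Data.Sum using (_⊎_; inj₁; inj₂)
open import Data.Empty using (⊥-elim)
open import Function using (_∘_)
open import Relation.Nullary using (yes; no)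
open import Relation.Binary.PropositionalEquality using (_≡_; _≢_; refl; sym; trans; cong)

private variable
  n : ℕ
  A : Set

-- The largest disc is the last entry of a word, so words of P^(n+1) are words of P^n extended by
-- snoc.

data SnocView {n : ℕ} : Fin (suc n) → Set where
  below : (i : Fin n) → SnocView (inject₁ i)
  top   : SnocView (fromℕ n)

snocView : (k : Fin (suc n)) → SnocView k
snocView {zero}  Fin.zero    = top
snocView {suc n} Fin.zero    = below Fin.zero
snocView {suc n} (Fin.suc k) with snocView k
... | below i = below (Fin.suc i)
... | top     = top

lookup-∷ʳ-inject₁ : (w : Vec A n) (x : A) (i : Fin n) → lookup (w ∷ʳ x) (inject₁ i) ≡ lookup w i
lookup-∷ʳ-inject₁ (y ∷ w) x Fin.zero    = refl
lookup-∷ʳ-inject₁ (y ∷ w) x (Fin.suc i) = lookup-∷ʳ-inject₁ w x i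

lookup-∷ʳ-fromℕ : (w : Vec A n) (x : A) → lookup (w ∷ʳ x) (fromℕ n) ≡ x
lookup-∷ʳ-fromℕ []      x = refl
lookup-∷ʳ-fromℕ (y ∷ w) x = lookup-∷ʳ-fromℕ w x

IsVertex-∷ʳ⁺ : {w : Word n} {x : Peg} → IsVertex w → AllowedPeg (suc n) x → IsVertex (w ∷ʳ x)
IsVertex-∷ʳ⁺ {n} {w} {x} w-vertex x-allowed k with snocView k
... | below i rewrite lookup-∷ʳ-inject₁ w x i | toℕ-inject₁ i = w-vertex i
... | top     rewrite lookup-∷ʳ-fromℕ w x | toℕ-fromℕ n = x-allowed

IsVertex-∷ʳ⁻ : {w : Word n} {x : Peg} → IsVertex (w ∷ʳ x) → IsVertex w × AllowedPeg (suc n) x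
IsVertex-∷ʳ⁻ {n} {w} {x} wx-vertex = lower , upper
  where
  lower : IsVertex w
  lower i with wx-vertex (inject₁ i)
  ... | allowed rewrite lookup-∷ʳ-inject₁ w x i | toℕ-inject₁ i = allowed
  upper : AllowedPeg (suc n) x
  upper with wx-vertex (fromℕ n)
  ... | allowed rewrite lookup-∷ʳ-fromℕ w x | toℕ-fromℕ n = allowed

Adjacent-∷ʳ : {w v : Word n} (c : Peg) → Adjacent w v → Adjacent (w ∷ʳ c) (v ∷ʳ c)
Adjacent-∷ʳ {n} {w} {v} c (d , moved , from-allowed , to-allowed , fixed , free) =
  inject₁ d , moved′ , from-allowed′ , to-allowed′ , fixed′ , free′
  where
  moved′ : lookup (w ∷ʳ c) (inject₁ d) ≢ lookup (v ∷ʳ c) (inject₁ d)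
  moved′ rewrite lookup-∷ʳ-inject₁ w c d | lookup-∷ʳ-inject₁ v c d = moved
  from-allowed′ : AllowedPeg (disc (inject₁ d)) (lookup (w ∷ʳ c) (inject₁ d))
  from-allowed′ rewrite lookup-∷ʳ-inject₁ w c d | toℕ-inject₁ d = from-allowed
  to-allowed′ : AllowedPeg (disc (inject₁ d)) (lookup (v ∷ʳ c) (inject₁ d))
  to-allowed′ rewrite lookup-∷ʳ-inject₁ v c d | toℕ-inject₁ d = to-allowed
  fixed′ : (k : Fin (suc n)) → k ≢ inject₁ d → lookup (w ∷ʳ c) k ≡ lookup (v ∷ʳ c) k
  fixed′ k k≢d with snocView k
  ... | below i rewrite lookup-∷ʳ-inject₁ w c i | lookup-∷ʳ-inject₁ v c i =
    fixed i (k≢d ∘ cong inject₁)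
  ... | top rewrite lookup-∷ʳ-fromℕ w c | lookup-∷ʳ-fromℕ v c = refl
  free′ : (k : Fin (suc n)) → toℕ k < toℕ (inject₁ d) →
          (lookup (w ∷ʳ c) k ≢ lookup (w ∷ʳ c) (inject₁ d))
          × (lookup (w ∷ʳ c) k ≢ lookup (v ∷ʳ c) (inject₁ d))
  free′ k k<d with snocView k
  ... | below i rewrite lookup-∷ʳ-inject₁ w c i | lookup-∷ʳ-inject₁ w c d
                      | lookup-∷ʳ-inject₁ v c d | toℕ-inject₁ i | toℕ-inject₁ d = free i k<d
  ... | top rewrite toℕ-fromℕ n | toℕ-inject₁ d = ⊥-elim (<-irrefl refl (<-trans k<d (toℕ<n d)))

Adjacent-moveTop : (w : Word n) {x y : Peg} → x ≢ y →
                   AllowedPeg (suc n) x → AllowedPeg (suc n) y →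
                   (∀ k → lookup w k ≢ x) → (∀ k → lookup w k ≢ y) →
                   Adjacent (w ∷ʳ x) (w ∷ʳ y)
Adjacent-moveTop {n} w {x} {y} x≢y x-allowed y-allowed w≢x w≢y =
  fromℕ n , moved , x-allowed′ , y-allowed′ , fixed , free
  where
  moved : lookup (w ∷ʳ x) (fromℕ n) ≢ lookup (w ∷ʳ y) (fromℕ n)
  moved rewrite lookup-∷ʳ-fromℕ w x | lookup-∷ʳ-fromℕ w y = x≢y
  x-allowed′ : AllowedPeg (disc (fromℕ n)) (lookup (w ∷ʳ x) (fromℕ n))
  x-allowed′ rewrite lookup-∷ʳ-fromℕ w x | toℕ-fromℕ n = x-allowed
  y-allowed′ : AllowedPeg (disc (fromℕ n)) (lookup (w ∷ʳ y) (fromℕ n))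
  y-allowed′ rewrite lookup-∷ʳ-fromℕ w y | toℕ-fromℕ n = y-allowed
  fixed : (k : Fin (suc n)) → k ≢ fromℕ n → lookup (w ∷ʳ x) k ≡ lookup (w ∷ʳ y) k
  fixed k k≢top with snocView k
  ... | below i rewrite lookup-∷ʳ-inject₁ w x i | lookup-∷ʳ-inject₁ w y i = refl
  ... | top = ⊥-elim (k≢top refl)
  free : (k : Fin (suc n)) → toℕ k < toℕ (fromℕ n) →
         (lookup (w ∷ʳ x) k ≢ lookup (w ∷ʳ x) (fromℕ n))
         × (lookup (w ∷ʳ x) k ≢ lookup (w ∷ʳ y) (fromℕ n))
  free k k<top with snocView k
  ... | below i rewrite lookup-∷ʳ-inject₁ w x i | lookup-∷ʳ-fromℕ w x | lookup-∷ʳ-fromℕ w y =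
    w≢x i , w≢y i
  ... | top = ⊥-elim (<-irrefl refl k<top)

data Role : Set where
  neutral₀ reserved neutral₃ : Role

private variable
  ρ σ τ υ : Role

reservedPeg : ℕ → Peg
reservedPeg d with 2 ∣? d
... | yes _ = # 1
... | no  _ = # 2

reservedPeg-allowed : ∀ d → AllowedPeg d (reservedPeg d)
reservedPeg-allowed d with 2 ∣? d
... | yes even = evenPeg even
... | no  odd  = oddPeg odd

reservedPeg-notNeutral : ∀ d → reservedPeg d ≢ # 0 × reservedPeg d ≢ # 3
reservedPeg-notNeutral d with 2 ∣? d
... | yes _ = (λ ()) , (λ ())
... | no  _ = (λ ()) , (λ ())

peg : Role → ℕ → Peg
peg neutral₀ d = # 0
peg reserved d = reservedPeg d
peg neutral₃ d = # 3

peg-allowed : ∀ ρ d → AllowedPeg d (peg ρ d)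
peg-allowed neutral₀ d = neutral0
peg-allowed reserved d = reservedPeg-allowed d
peg-allowed neutral₃ d = neutral3

allowed⇒peg : ∀ {d x} → AllowedPeg d x → ∃ λ ρ → x ≡ peg ρ d
allowed⇒peg neutral0 = neutral₀ , refl
allowed⇒peg neutral3 = neutral₃ , refl
allowed⇒peg {d} (evenPeg even) = reserved , is-reserved
  where
  is-reserved : # 1 ≡ reservedPeg d
  is-reserved with 2 ∣? d
  ... | yes _  = refl
  ... | no odd = ⊥-elim (odd even)
allowed⇒peg {d} (oddPeg odd) = reserved , is-reserved
  where
  is-reserved : # 2 ≡ reservedPeg d
  is-reserved with 2 ∣? d
  ... | yes even = ⊥-elim (odd even)
  ... | no  _    = refl

peg-injective : ∀ d e → peg ρ d ≡ peg σ e → ρ ≡ σ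
peg-injective {neutral₀} {neutral₀} d e eq = refl
peg-injective {neutral₀} {reserved} d e eq = ⊥-elim (proj₁ (reservedPeg-notNeutral e) (sym eq))
peg-injective {neutral₀} {neutral₃} d e ()
peg-injective {reserved} {neutral₀} d e eq = ⊥-elim (proj₁ (reservedPeg-notNeutral d) eq)
peg-injective {reserved} {reserved} d e eq = refl
peg-injective {reserved} {neutral₃} d e eq = ⊥-elim (proj₂ (reservedPeg-notNeutral d) eq)
peg-injective {neutral₃} {neutral₀} d e ()
peg-injective {neutral₃} {reserved} d e eq = ⊥-elim (proj₂ (reservedPeg-notNeutral e) (sym eq))
peg-injective {neutral₃} {neutral₃} d e eq = refl

data Arrangement : Role → Role → Role → Set where
  canonical : Arrangement neutral₀ reserved neutral₃
  swapˡ     : Arrangement ρ σ τ → Arrangement σ ρ τ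
  swapʳ     : Arrangement ρ σ τ → Arrangement ρ τ σ

reverse : Arrangement ρ σ τ → Arrangement τ σ ρ
reverse = swapˡ ∘ swapʳ ∘ swapˡ

Arrangement-distinct : Arrangement ρ σ τ → ρ ≢ σ × σ ≢ τ × ρ ≢ τ
Arrangement-distinct canonical = (λ ()) , (λ ()) , (λ ())
Arrangement-distinct (swapˡ a) with Arrangement-distinct a
... | ρ≢σ , σ≢τ , ρ≢τ = ρ≢σ ∘ sym , ρ≢τ , σ≢τ
Arrangement-distinct (swapʳ a) with Arrangement-distinct a
... | ρ≢σ , σ≢τ , ρ≢τ = ρ≢τ , σ≢τ ∘ sym , ρ≢σ

Arrangement-exhaustive : Arrangement ρ σ τ → ∀ υ → υ ≡ ρ ⊎ υ ≡ σ ⊎ υ ≡ τ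
Arrangement-exhaustive canonical neutral₀ = inj₁ refl
Arrangement-exhaustive canonical reserved = inj₂ (inj₁ refl)
Arrangement-exhaustive canonical neutral₃ = inj₂ (inj₂ refl)
Arrangement-exhaustive (swapˡ a) υ with Arrangement-exhaustive a υ
... | inj₁ υ≡ρ        = inj₂ (inj₁ υ≡ρ)
... | inj₂ (inj₁ υ≡σ) = inj₁ υ≡σ
... | inj₂ (inj₂ υ≡τ) = inj₂ (inj₂ υ≡τ)
Arrangement-exhaustive (swapʳ a) υ with Arrangement-exhaustive a υ
... | inj₁ υ≡ρ        = inj₁ υ≡ρ
... | inj₂ (inj₁ υ≡σ) = inj₂ (inj₂ υ≡σ)
... | inj₂ (inj₂ υ≡τ) = inj₂ (inj₁ υ≡τ)

perfect : Role → (n : ℕ) → Word n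
perfect ρ zero    = []
perfect ρ (suc n) = perfect ρ n ∷ʳ peg ρ (suc n)

lookup-perfect : ∀ ρ n (k : Fin n) → lookup (perfect ρ n) k ≡ peg ρ (disc k)
lookup-perfect ρ (suc n) k with snocView k
... | below i rewrite lookup-∷ʳ-inject₁ (perfect ρ n) (peg ρ (suc n)) i | toℕ-inject₁ i =
  lookup-perfect ρ n i
... | top rewrite lookup-∷ʳ-fromℕ (perfect ρ n) (peg ρ (suc n)) | toℕ-fromℕ n = refl

perfect-avoids : υ ≢ ρ → ∀ d (k : Fin n) → lookup (perfect υ n) k ≢ peg ρ d
perfect-avoids {υ = υ} {n = n} υ≢ρ d k eq =
  υ≢ρ (peg-injective _ d (trans (sym (lookup-perfect υ n k)) eq))

perfect-moveTop : ∀ υ ρ σ → ρ ≢ σ → υ ≢ ρ → υ ≢ σ →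
                  Adjacent (perfect υ n ∷ʳ peg ρ (suc n)) (perfect υ n ∷ʳ peg σ (suc n))
perfect-moveTop {n} υ ρ σ ρ≢σ υ≢ρ υ≢σ =
  Adjacent-moveTop (perfect υ n) (ρ≢σ ∘ peg-injective (suc n) (suc n))
    (peg-allowed ρ (suc n)) (peg-allowed σ (suc n))
    (perfect-avoids υ≢ρ (suc n)) (perfect-avoids υ≢σ (suc n))

Walk : Word n → List (Word n) → Word n → Set
Walk x []       y = x ≡ y
Walk x (v ∷ vs) y = Adjacent x v × Walk v vs y

Walk-++ : {x y z u : Word n} (vs : List (Word n)) {ws : List (Word n)} →
          Walk x vs y → Adjacent y z → Walk z ws u → Walk x (vs ++ z ∷ ws) u
Walk-++ []       refl           y~z walk′ = y~z , walk′
Walk-++ (v ∷ vs) (x~v , walk) y~z walk′ = x~v , Walk-++ vs walk y~z walk′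

Walk⇒ChainFrom : {x y first : Word n} (vs : List (Word n)) →
                 Walk x vs y → Adjacent y first → ChainFrom first x vs
Walk⇒ChainFrom []       refl           y~first = y~first
Walk⇒ChainFrom (v ∷ vs) (x~v , walk) y~first = x~v , Walk⇒ChainFrom vs walk y~first

layer : Peg → List (Word n) → List (Word (suc n))
layer c = map (_∷ʳ c)

Walk-layer : {x y : Word n} (c : Peg) (vs : List (Word n)) →
             Walk x vs y → Walk (x ∷ʳ c) (layer c vs) (y ∷ʳ c)
Walk-layer         c []       refl         = refl
Walk-layer {x = x} c (v ∷ vs) (x~v , walk) = Adjacent-∷ʳ {w = x} {v = v} c x~v , Walk-layer c vs walk

Unique-layer : {vs : List (Word n)} (c : Peg) → Unique vs → Unique (layer c vs)
Unique-layer c = Unique.map⁺ (λ {w} {v} → ∷ʳ-injectiveˡ w v)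

layer-disjoint : {c c′ : Peg} → c ≢ c′ → (vs ws : List (Word n)) →
                 Disjoint (layer c vs) (layer c′ ws)
layer-disjoint c≢c′ vs ws (in-vs , in-ws) with ∈-map⁻ _ in-vs | ∈-map⁻ _ in-ws
... | w , _ , refl | w′ , _ , eq = c≢c′ (∷ʳ-injectiveʳ w w′ eq)

Disjoint-++⁺ʳ : {xs ys zs : List A} → Disjoint xs ys → Disjoint xs zs → Disjoint xs (ys ++ zs)
Disjoint-++⁺ʳ {ys = ys} xs#ys xs#zs (in-xs , in-ys++zs) with ∈-++⁻ ys in-ys++zs
... | inj₁ in-ys = xs#ys (in-xs , in-ys)
... | inj₂ in-zs = xs#zs (in-xs , in-zs)

2≤length-++-∷-++-∷ : (xs ys zs : List A) (y z : A) → 2 ≤ length (xs ++ y ∷ (ys ++ z ∷ zs))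
2≤length-++-∷-++-∷ []       []       zs y z = s≤s (s≤s z≤n)
2≤length-++-∷-++-∷ []       (_ ∷ ys) zs y z = s≤s (s≤s z≤n)
2≤length-++-∷-++-∷ (_ ∷ xs) ys       zs y z = m≤n⇒m≤1+n (2≤length-++-∷-++-∷ xs ys zs y z)

record HamPath (n : ℕ) (x y : Word n) : Set where
  field
    rest     : List (Word n)
    walk     : Walk x rest y
    unique   : Unique (x ∷ rest)
    vertices : All IsVertex (x ∷ rest)
    complete : ∀ s → IsVertex s → s ∈ x ∷ rest

HamPath-trivial : HamPath zero [] []
HamPath-trivial = record
  { rest     = []
  ; walk     = refl
  ; unique   = [] ∷ []
  ; vertices = (λ ()) ∷ []
  ; complete = λ { [] _ → here refl }
  }

module _ {n : ℕ} {ρ σ τ : Role} (a : Arrangement ρ σ τ) where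

  private
    topPeg : Role → Peg
    topPeg υ = peg υ (suc n)

  stack : {x₁ y₁ x₂ y₂ x₃ y₃ : Word n} →
          HamPath n x₁ y₁ → HamPath n x₂ y₂ → HamPath n x₃ y₃ →
          Adjacent (y₁ ∷ʳ topPeg ρ) (x₂ ∷ʳ topPeg σ) → Adjacent (y₂ ∷ʳ topPeg σ) (x₃ ∷ʳ topPeg τ) →
          HamPath (suc n) (x₁ ∷ʳ topPeg ρ) (y₃ ∷ʳ topPeg τ)
  stack {x₁} {x₂ = x₂} {x₃ = x₃} p₁ p₂ p₃ step₁₂ step₂₃ = record
    { rest     = layer (topPeg ρ) r₁ ++ (x₂ ∷ʳ topPeg σ)
                   ∷ (layer (topPeg σ) r₂ ++ (x₃ ∷ʳ topPeg τ) ∷ layer (topPeg τ) r₃)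
    ; walk     = Walk-++ (layer (topPeg ρ) r₁) (Walk-layer (topPeg ρ) r₁ (walk p₁)) step₁₂
                   (Walk-++ (layer (topPeg σ) r₂) (Walk-layer (topPeg σ) r₂ (walk p₂)) step₂₃
                     (Walk-layer (topPeg τ) r₃ (walk p₃)))
    ; unique   = Unique.++⁺ (Unique-layer (topPeg ρ) (unique p₁))
                   (Unique.++⁺ (Unique-layer (topPeg σ) (unique p₂)) (Unique-layer (topPeg τ) (unique p₃))
                     (layer-disjoint (topPeg-≢ σ≢τ) L₂ L₃))
                   (Disjoint-++⁺ʳ (layer-disjoint (topPeg-≢ ρ≢σ) L₁ L₂) (layer-disjoint (topPeg-≢ ρ≢τ) L₁ L₃))
    ; vertices = All.++⁺ (layer-vertices ρ (vertices p₁))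
                   (All.++⁺ (layer-vertices σ (vertices p₂)) (layer-vertices τ (vertices p₃)))
    ; complete = complete′
    }
    where
    open HamPath
    r₁ = rest p₁
    r₂ = rest p₂
    r₃ = rest p₃
    L₁ = x₁ ∷ r₁
    L₂ = x₂ ∷ r₂
    L₃ = x₃ ∷ r₃

    distinct = Arrangement-distinct a
    ρ≢σ = proj₁ distinct
    σ≢τ = proj₁ (proj₂ distinct)
    ρ≢τ = proj₂ (proj₂ distinct)

    topPeg-≢ : {υ υ′ : Role} → υ ≢ υ′ → topPeg υ ≢ topPeg υ′
    topPeg-≢ υ≢υ′ = υ≢υ′ ∘ peg-injective (suc n) (suc n)

    layer-vertices : ∀ υ {vs} → All IsVertex vs → All IsVertex (layer (topPeg υ) vs)
    layer-vertices υ = All.gmap⁺ (λ {w} w-vertex → IsVertex-∷ʳ⁺ {w = w} w-vertex (peg-allowed υ (suc n)))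

    complete′ : ∀ s → IsVertex s → s ∈ layer (topPeg ρ) L₁ ++ layer (topPeg σ) L₂ ++ layer (topPeg τ) L₃
    complete′ s s-vertex with initLast s
    ... | w , x , refl with IsVertex-∷ʳ⁻ {w = w} s-vertex
    ... | w-vertex , x-allowed with allowed⇒peg x-allowed
    ... | υ , refl with Arrangement-exhaustive a υ
    ... | inj₁ refl        = ∈-++⁺ˡ (∈-map⁺ _ (complete p₁ w w-vertex))
    ... | inj₂ (inj₁ refl) = ∈-++⁺ʳ (layer (topPeg ρ) L₁) (∈-++⁺ˡ (∈-map⁺ _ (complete p₂ w w-vertex)))
    ... | inj₂ (inj₂ refl) =
      ∈-++⁺ʳ (layer (topPeg ρ) L₁) (∈-++⁺ʳ (layer (topPeg σ) L₂) (∈-map⁺ _ (complete p₃ w w-vertex)))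

  stackCycle : {x₁ y₁ x₂ y₂ x₃ y₃ : Word n} →
               HamPath n x₁ y₁ → HamPath n x₂ y₂ → HamPath n x₃ y₃ →
               Adjacent (y₁ ∷ʳ topPeg ρ) (x₂ ∷ʳ topPeg σ) → Adjacent (y₂ ∷ʳ topPeg σ) (x₃ ∷ʳ topPeg τ) →
               Adjacent (y₃ ∷ʳ topPeg τ) (x₁ ∷ʳ topPeg ρ) →
               Σ (List (Word (suc n))) (HamiltonianCycle (suc n))
  stackCycle {x₁} {x₂ = x₂} {x₃ = x₃} p₁ p₂ p₃ step₁₂ step₂₃ step₃₁ =
    (x₁ ∷ʳ topPeg ρ) ∷ rest path ,
    s≤s (2≤length-++-∷-++-∷ (layer (topPeg ρ) (rest p₁)) (layer (topPeg σ) (rest p₂))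
          (layer (topPeg τ) (rest p₃)) (x₂ ∷ʳ topPeg σ) (x₃ ∷ʳ topPeg τ)) ,
    vertices path , unique path , complete path , Walk⇒ChainFrom (rest path) (walk path) step₃₁
    where
    open HamPath
    path = stack p₁ p₂ p₃ step₁₂ step₂₃

perfectPaths : ∀ n {ρ σ τ} → Arrangement ρ σ τ → HamPath n (perfect ρ n) (perfect τ n)
perfectPaths zero    a = HamPath-trivial
perfectPaths (suc n) {ρ} {σ} {τ} a with Arrangement-distinct a
... | ρ≢σ , σ≢τ , ρ≢τ =
  stack a (perfectPaths n a) (perfectPaths n (reverse a)) (perfectPaths n a)
    (perfect-moveTop τ ρ σ ρ≢σ (ρ≢τ ∘ sym) (σ≢τ ∘ sym)) (perfect-moveTop ρ σ τ σ≢τ ρ≢σ ρ≢τ)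

theorem6p21 : (n : ℕ) → 1 ≤ n → Σ (List (Word n)) (HamiltonianCycle n)
theorem6p21 (suc n) _ =
  stackCycle canonical
    (perfectPaths n (swapˡ canonical)) (perfectPaths n (reverse canonical)) (perfectPaths n (swapʳ canonical))
    (perfect-moveTop neutral₃ neutral₀ reserved (λ ()) (λ ()) (λ ()))
    (perfect-moveTop neutral₀ reserved neutral₃ (λ ()) (λ ()) (λ ()))
    (perfect-moveTop reserved neutral₃ neutral₀ (λ ()) (λ ()) (λ ()))
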